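{- Let $G$ be a graph with minimum degree $\delta(G) > \frac{3}{4} v(G)$. Then for every $e \in E(G)$, $$\sum_{T \in \mathcal{K}_3(G,e)}w_G(T)=1.$$
   Context: $\mathcal{K}_\ell(G)$ is the set of cliques on $\ell$ vertices of $G$; for a vertex set $S$ (or subgraph), $\mathcal{K}_\ell(G,S)$ is the set of those containing $S$. An ordered $r$-clique is a tuple $(v_1,\ldots,v_r)$ of distinct vertices spanning a clique; $\mathcal{OK}_r(G)$ is the set of these. For $(v_1,\ldots,v_r)\in\mathcal{OK}_r(G)$, $r\in\{2,3,4\}$, define $W(v_1,\ldots,v_r)=\prod_{i=2}^r \frac{1}{|\mathcal{K}_{i+1}(G,\{v_1,\ldots,v_i\})|}$. For $K\in\mathcal{K}_5(G)$ and $e\in E(K)$, the edge-gadget $\psi_{K,e}$ is the function on triangles $T$ of $G$ equal to $+\frac13$ if $T\subseteq K$ and $|e\cap V(T)|\in\{0,2\}$, $-\frac16$ if $T\subseteq K$ and $|e\cap V(T)|=1$, and $0$ otherwise. For $K=(v_1,\ldots,v_5)\in\mathcal{OK}_5(G)$ let $\psi_K(T)=\psi_{G[\{v_1,\ldots,v_5\}],v_1v_2}(T)$. Define $w_G(T)=\frac12\sum_{K=(v_1,\ldots,v_5)\in\mathcal{OK}_5(G)} W(v_1,\ldots,v_4)\,\psi_K(T)$ for each triangle $T$ of $G$. -}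

module Defs where

open import Data.Nat using (ℕ; zero; suc) renaming (_+_ to _+ℕ_)
open import Data.Integer using (+_; -[1+_])
open import Data.Rational using (ℚ; _/_; _+_; _*_; 0ℚ; 1ℚ)
open import Data.Fin using (Fin)
open import Data.Fin.Properties using (all?)
import Data.Fin.Properties as FinP
open import Data.Fin.Subset using (Subset; ⁅_⁆; _∪_; ⊥; ∣_∣; _∈_; _⊆_; inside; outside)
open import Data.Fin.Subset.Properties using (_∈?_; _⊆?_)
open import Data.List using (List; []; _∷_; [_]; map; concatMap; allFin; filter; foldr; take; length; upTo)
open import Data.List.Relation.Unary.AllPairs using (AllPairs)
import Data.List.Relation.Unary.AllPairs.Properties as AP
open import Data.Bool using (Bool; true; false; if_then_else_)
open import Data.Product using (_×_)
open import Data.Sum using (_⊎_)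
open import Relation.Nullary using (¬_; Dec; yes; no; does)
open import Relation.Nullary.Decidable using (_×-dec_; _⊎-dec_; _→-dec_; ¬?)
open import Relation.Binary using (Decidable)
open import Relation.Binary.PropositionalEquality using (_≡_; _≢_)
open import Data.List.Relation.Unary.AllPairs using (allPairs?)

record Graph (n : ℕ) : Set₁ where
  field
    Adj    : Fin n → Fin n → Set
    adj?   : Decidable Adj
    sym    : ∀ {x y} → Adj x y → Adj y x
    irrefl : ∀ {x} → ¬ Adj x x
open Graph public

module _ {n : ℕ} (G : Graph n) where

  degree : Fin n → ℕ
  degree v = length (filter (adj? G v) (allFin n))

  sumℚ : List ℚ → ℚ
  sumℚ = foldr _+_ 0ℚ

  productℚ : List ℚ → ℚ
  productℚ = foldr _*_ 1ℚ

  allSubsets : (m : ℕ) → List (Subset m)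
  allSubsets zero = [ Data.Fin.Subset.⊥ ]
  allSubsets (suc m) = concatMap (λ s → (inside Data.Vec.∷ s) ∷ (outside Data.Vec.∷ s) ∷ []) (allSubsets m)
    where import Data.Vec

  IsCliqueSet : Subset n → Set
  IsCliqueSet S = ∀ x y → x ∈ S → y ∈ S → x ≡ y ⊎ Adj G x y

  isCliqueSet? : (S : Subset n) → Dec (IsCliqueSet S)
  isCliqueSet? S = all? (λ x → all? (λ y →
     (x ∈? S) →-dec (y ∈? S) →-dec (x FinP.≟ y ⊎-dec adj? G x y)))

  𝒦 : ℕ → Subset n → List (Subset n)
  𝒦 ℓ S = filter (λ T → (∣ T ∣ Data.Nat.≟ ℓ) ×-dec (S ⊆? T) ×-dec isCliqueSet? T) (allSubsets n)
    where import Data.Nat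

  setOf : List (Fin n) → Subset n
  setOf = foldr (λ v s → ⁅ v ⁆ ∪ s) ⊥

  allTuples : ℕ → List (List (Fin n))
  allTuples zero = [ [] ]
  allTuples (suc r) = concatMap (λ v → map (v ∷_) (allTuples r)) (allFin n)

  IsOrderedClique : List (Fin n) → Set
  IsOrderedClique = AllPairs (λ x y → x ≢ y × Adj G x y)

  𝒪𝒦 : ℕ → List (List (Fin n))
  𝒪𝒦 r = filter (allPairs? (λ x y → ¬? (x FinP.≟ y) ×-dec adj? G x y)) (allTuples r)

  -- 1/k as a rational (with the convention 1/0 = 0; never used with k = 0 below)
  inv : ℕ → ℚ
  inv zero = 0ℚ
  inv (suc k) = + 1 / suc k

  -- W(v₁,…,v_r) = ∏_{i=2}^{r} 1 / |𝒦_{i+1}(G,{v₁,…,v_i})|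
  W : List (Fin n) → ℚ
  W vs = productℚ (map (λ j → inv (length (𝒦 (suc (suc (suc j))) (setOf (take (suc (suc j)) vs)))))
                       (upTo (length vs Data.Nat.∸ 1)))
    where import Data.Nat

  meet : Fin n → Fin n → Subset n → ℕ
  meet a b T = (if does (a ∈? T) then 1 else 0) +ℕ (if does (b ∈? T) then 1 else 0)

  edgeGadget : Subset n → Fin n → Fin n → Subset n → ℚ
  edgeGadget K a b T with does (T ⊆? K) | meet a b T
  ... | false | _ = 0ℚ
  ... | true  | 1 = -[1+ 0 ] / 6
  ... | true  | _ = + 1 / 3

  ψ : List (Fin n) → Subset n → ℚ
  ψ (v₁ ∷ v₂ ∷ rest) T = edgeGadget (setOf (v₁ ∷ v₂ ∷ rest)) v₁ v₂ T
  ψ _ T = 0ℚ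

  w : Subset n → ℚ
  w T = (+ 1 / 2) * sumℚ (map (λ K → W (take 4 K) * ψ K T) (𝒪𝒦 5))

-- Summing w over the triangles through e = uv and exchanging the order of summation leaves,
-- for each ordered 5-clique K = (v₁,…,v₅), the sum of the edge-gadget ψ_K over those triangles.
-- A triangle {x,u,v} contributes only when it lies inside K, so this is a finite computation
-- inside K: the sum is 1 if {v₁,v₂} = {u,v} and 0 otherwise.  Hence the total is half the
-- W-weight of the ordered 5-cliques starting with (u,v), plus that of those starting with (v,u).
-- The (i+1)-cliques containing an i-clique correspond to its common neighbours, so W(v₁,…,v₄) is
-- the probability of growing (v₁,v₂) into (v₁,…,v₅) by adding, at each step, a uniformly random
-- common neighbour of the vertices chosen so far.  When δ(G) > 3n/4 any at most four vertices
-- have a common neighbour, so this process never gets stuck and each of the two weights is 1.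

module Submission where

open import Defs
open import Data.Nat using (ℕ)

module ListSum where

  open import Data.Nat using (ℕ; suc)
  import Data.Integer as ℤ
  open import Data.Rational using (ℚ; mkℚ; _/_; _+_; _*_; 0ℚ; 1ℚ)
  open import Data.Rational.Properties
  open import Data.Nat.Coprimality using (1-coprimeTo) renaming (sym to coprime-sym)
  open import Data.List using (List; []; _∷_; map; foldr; length; filter; concatMap; _++_)
  open import Data.List.Membership.Propositional using (_∈_)
  open import Data.List.Relation.Unary.Any using (here; there)
  open import Data.List.Relation.Unary.All using (lookup)
  open import Data.List.Relation.Unary.Unique.Propositional using (Unique)
  open import Data.List.Relation.Unary.AllPairs using (_∷_)
  open import Data.List.Relation.Binary.Permutation.Propositional using (_↭_; ↭⇒↭ₛ)
  open import Data.List.Relation.Binary.Permutation.Propositional.Properties using (map⁺)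
  open import Data.List.Relation.Binary.Permutation.Setoid.Properties using (foldr-commMonoid)
  open import Data.Bool using (Bool; true; false; if_then_else_)
  open import Relation.Nullary using (¬_; yes; no; does)
  open import Relation.Nullary.Decidable using (does-⇔)
  open import Function.Bundles using (mk⇔)
  open import Relation.Unary using (Pred; Decidable)
  open import Relation.Binary.Definitions using (DecidableEquality)
  open import Relation.Binary.PropositionalEquality as ≡ using (_≡_; refl; cong; cong₂; trans)
  open import Data.Empty using (⊥-elim)
  open import Algebra.Bundles using (CommutativeMonoid)
  open import Algebra.Properties.CommutativeSemigroup
    (CommutativeMonoid.commutativeSemigroup +-0-commutativeMonoid) using () renaming (interchange to +-interchange)
  open ≡.≡-Reasoning

  ∑ : ∀ {a} {A : Set a} → List A → (A → ℚ) → ℚ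
  ∑ xs f = foldr _+_ 0ℚ (map f xs)

  𝟙 : Bool → ℚ
  𝟙 b = if b then 1ℚ else 0ℚ

  module _ {a} {A : Set a} where

    ∑-cong-∈ : ∀ (xs : List A) {f g : A → ℚ} → (∀ {x} → x ∈ xs → f x ≡ g x) → ∑ xs f ≡ ∑ xs g
    ∑-cong-∈ []       f≗g = refl
    ∑-cong-∈ (x ∷ xs) f≗g = cong₂ _+_ (f≗g (here refl)) (∑-cong-∈ xs (λ p → f≗g (there p)))

    ∑-cong : ∀ (xs : List A) {f g : A → ℚ} → (∀ x → f x ≡ g x) → ∑ xs f ≡ ∑ xs g
    ∑-cong xs f≗g = ∑-cong-∈ xs (λ {x} _ → f≗g x)

    ∑-zero : ∀ (xs : List A) {f : A → ℚ} → (∀ {x} → x ∈ xs → f x ≡ 0ℚ) → ∑ xs f ≡ 0ℚ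
    ∑-zero []       f≗0 = refl
    ∑-zero (x ∷ xs) f≗0 = cong₂ _+_ (f≗0 (here refl)) (∑-zero xs (λ p → f≗0 (there p)))

    ∑-++ : ∀ (xs ys : List A) (f : A → ℚ) → ∑ (xs ++ ys) f ≡ ∑ xs f + ∑ ys f
    ∑-++ []       ys f = ≡.sym (+-identityˡ _)
    ∑-++ (x ∷ xs) ys f = trans (cong (f x +_) (∑-++ xs ys f)) (≡.sym (+-assoc (f x) _ _))

    ∑-+ : ∀ (xs : List A) (f g : A → ℚ) → ∑ xs (λ x → f x + g x) ≡ ∑ xs f + ∑ xs g
    ∑-+ []       f g = refl
    ∑-+ (x ∷ xs) f g =
      trans (cong ((f x + g x) +_) (∑-+ xs f g)) (+-interchange (f x) (g x) (∑ xs f) (∑ xs g))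

    ∑-*ˡ : ∀ (xs : List A) (c : ℚ) (f : A → ℚ) → ∑ xs (λ x → c * f x) ≡ c * ∑ xs f
    ∑-*ˡ []       c f = ≡.sym (*-zeroʳ c)
    ∑-*ˡ (x ∷ xs) c f = trans (cong (c * f x +_) (∑-*ˡ xs c f)) (≡.sym (*-distribˡ-+ c (f x) _))

    ∑-*ʳ : ∀ (xs : List A) (c : ℚ) (f : A → ℚ) → ∑ xs (λ x → f x * c) ≡ ∑ xs f * c
    ∑-*ʳ xs c f = trans (∑-cong xs (λ x → *-comm (f x) c)) (trans (∑-*ˡ xs c f) (*-comm c _))

    ∑-filter : ∀ {p} {P : Pred A p} (P? : Decidable P) (xs : List A) (f : A → ℚ) →
               ∑ (filter P? xs) f ≡ ∑ xs (λ x → if does (P? x) then f x else 0ℚ)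
    ∑-filter P? []       f = refl
    ∑-filter P? (x ∷ xs) f with does (P? x)
    ... | true  = cong (f x +_) (∑-filter P? xs f)
    ... | false = trans (∑-filter P? xs f) (≡.sym (+-identityˡ _))

    ∑-↭ : ∀ {xs ys : List A} (f : A → ℚ) → xs ↭ ys → ∑ xs f ≡ ∑ ys f
    ∑-↭ f xs↭ys = foldr-commMonoid (≡.setoid ℚ) +-0-isCommutativeMonoid (↭⇒↭ₛ (map⁺ f xs↭ys))

  module _ {a b} {A : Set a} {B : Set b} where

    ∑-map : ∀ (g : A → B) (xs : List A) (f : B → ℚ) → ∑ (map g xs) f ≡ ∑ xs (λ x → f (g x))
    ∑-map g []       f = refl
    ∑-map g (x ∷ xs) f = cong (f (g x) +_) (∑-map g xs f)

    ∑-concatMap : ∀ (g : A → List B) (xs : List A) (f : B → ℚ) →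
                  ∑ (concatMap g xs) f ≡ ∑ xs (λ x → ∑ (g x) f)
    ∑-concatMap g []       f = refl
    ∑-concatMap g (x ∷ xs) f =
      trans (∑-++ (g x) (concatMap g xs) f) (cong (∑ (g x) f +_) (∑-concatMap g xs f))

    ∑-comm : ∀ (xs : List A) (ys : List B) (f : A → B → ℚ) →
             ∑ xs (λ x → ∑ ys (f x)) ≡ ∑ ys (λ y → ∑ xs (λ x → f x y))
    ∑-comm []       ys f = ≡.sym (∑-zero ys (λ _ → refl))
    ∑-comm (x ∷ xs) ys f =
      trans (cong (∑ ys (f x) +_) (∑-comm xs ys f)) (≡.sym (∑-+ ys (f x) (λ y → ∑ xs (λ x → f x y))))

  fromℕ : ℕ → ℚ
  fromℕ k = mkℚ (ℤ.+ k) 0 (coprime-sym (1-coprimeTo k))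

  fromℕ-suc : ∀ k → fromℕ (suc k) ≡ 1ℚ + fromℕ k
  fromℕ-suc k = toℚᵘ-injective (ℚᵘ.≃-trans (ℚᵘ.*≡* eq) (ℚᵘ.≃-sym (toℚᵘ-homo-+ 1ℚ (fromℕ k))))
    where
    import Data.Rational.Unnormalised.Base as ℚᵘ
    import Data.Rational.Unnormalised.Properties as ℚᵘ
    open import Data.Integer.Properties using () renaming (*-identityʳ to ℤ*-identityʳ)
    open ℤ using (+_)
    eq : + suc k ℤ.* + 1 ≡ (+ 1 ℤ.+ + k ℤ.* + 1) ℤ.* + 1
    eq = trans (ℤ*-identityʳ _) (≡.sym (trans (ℤ*-identityʳ _) (cong (λ z → + 1 ℤ.+ z) (ℤ*-identityʳ (+ k)))))

  fromℕ-*-inverse : ∀ m → fromℕ (suc m) * (ℤ.+ 1 / suc m) ≡ 1ℚ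
  fromℕ-*-inverse m = begin
    fromℕ (suc m) * (ℤ.+ 1 / suc m)          ≡⟨ cong (fromℕ (suc m) *_) (normalize-coprime {1} {m} (1-coprimeTo (suc m))) ⟩
    fromℕ (suc m) * 1/ (fromℕ (suc m))     ≡⟨ *-inverseʳ (fromℕ (suc m)) ⟩
    1ℚ                                     ∎
    where open import Data.Rational using (1/_)

  ∑-const : ∀ {a} {A : Set a} (xs : List A) (c : ℚ) → ∑ xs (λ _ → c) ≡ fromℕ (length xs) * c
  ∑-const []       c = ≡.sym (*-zeroˡ c)
  ∑-const (x ∷ xs) c = begin
    c + ∑ xs (λ _ → c)                 ≡⟨ cong₂ _+_ (≡.sym (*-identityˡ c)) (∑-const xs c) ⟩
    1ℚ * c + fromℕ (length xs) * c     ≡⟨ *-distribʳ-+ c 1ℚ (fromℕ (length xs)) ⟨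
    (1ℚ + fromℕ (length xs)) * c       ≡⟨ cong (_* c) (fromℕ-suc (length xs)) ⟨
    fromℕ (suc (length xs)) * c        ∎

  ∑-average : ∀ {a} {A : Set a} (xs : List A) (m : ℕ) (c : ℚ) → length xs ≡ suc m →
              ∑ xs (λ _ → (ℤ.+ 1 / suc m) * c) ≡ c
  ∑-average xs m c len = begin
    ∑ xs (λ _ → (ℤ.+ 1 / suc m) * c)                 ≡⟨ ∑-const xs _ ⟩
    fromℕ (length xs) * ((ℤ.+ 1 / suc m) * c)        ≡⟨ cong (λ k → fromℕ k * ((ℤ.+ 1 / suc m) * c)) len ⟩
    fromℕ (suc m) * ((ℤ.+ 1 / suc m) * c)            ≡⟨ *-assoc (fromℕ (suc m)) (ℤ.+ 1 / suc m) c ⟨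
    (fromℕ (suc m) * (ℤ.+ 1 / suc m)) * c            ≡⟨ cong (_* c) (fromℕ-*-inverse m) ⟩
    1ℚ * c                                         ≡⟨ *-identityˡ c ⟩
    c                                              ∎

  module KroneckerDelta {a} {A : Set a} (_≟_ : DecidableEquality A) where

    open import Data.List.Membership.DecPropositional _≟_ using (_∈?_)

    δ : A → A → ℚ
    δ x y = 𝟙 (does (x ≟ y))

    δ-refl : ∀ x → δ x x ≡ 1ℚ
    δ-refl x with x ≟ x
    ... | yes _   = refl
    ... | no x≢x = ⊥-elim (x≢x refl)

    δ-≢ : ∀ {x y} → ¬ x ≡ y → δ x y ≡ 0ℚ
    δ-≢ {x} {y} x≢y with x ≟ y
    ... | yes x≡y = ⊥-elim (x≢y x≡y)
    ... | no _    = refl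

    ∑-δ-∉ : ∀ (xs : List A) (f : A → ℚ) {u} → ¬ u ∈ xs → ∑ xs (λ x → f x * δ x u) ≡ 0ℚ
    ∑-δ-∉ xs f u∉xs = ∑-zero xs (λ {x} x∈xs →
      trans (cong (f x *_) (δ-≢ (λ x≡u → u∉xs (≡.subst (_∈ xs) x≡u x∈xs)))) (*-zeroʳ (f x)))

    ∑-δ : ∀ (xs : List A) (u : A) (f : A → ℚ) → Unique xs → u ∈ xs → ∑ xs (λ x → f x * δ x u) ≡ f u
    ∑-δ (x ∷ xs) u f (x∉xs ∷ _) (here refl) = begin
      f x * δ x x + ∑ xs (λ y → f y * δ y x) ≡⟨ cong₂ _+_ (cong (f x *_) (δ-refl x))
                                                          (∑-δ-∉ xs f (λ x∈xs → lookup x∉xs x∈xs refl)) ⟩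
      f x * 1ℚ + 0ℚ                          ≡⟨ +-identityʳ _ ⟩
      f x * 1ℚ                               ≡⟨ *-identityʳ (f x) ⟩
      f x                                    ∎
    ∑-δ (x ∷ xs) u f (x∉xs ∷ !xs) (there u∈xs) = begin
      f x * δ x u + ∑ xs (λ y → f y * δ y u) ≡⟨ cong₂ _+_ (cong (f x *_) (δ-≢ (lookup x∉xs u∈xs)))
                                                          (∑-δ xs u f !xs u∈xs) ⟩
      f x * 0ℚ + f u                         ≡⟨ cong (_+ f u) (*-zeroʳ (f x)) ⟩
      0ℚ + f u                               ≡⟨ +-identityˡ (f u) ⟩
      f u                                    ∎

    δ-sym : ∀ x y → δ x y ≡ δ y x
    δ-sym x y = cong 𝟙 (does-⇔ (mk⇔ ≡.sym ≡.sym) (x ≟ y) (y ≟ x))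

    ∑-supported : ∀ (xs zs : List A) (g : A → ℚ) → Unique xs → Unique zs →
                  (∀ {z} → z ∈ zs → z ∈ xs) → (∀ {x} → ¬ x ∈ zs → g x ≡ 0ℚ) → ∑ xs g ≡ ∑ zs g
    ∑-supported xs zs g !xs !zs zs⊆xs g-vanishes = begin
      ∑ xs g                                   ≡⟨ ∑-cong xs expand ⟩
      ∑ xs (λ x → ∑ zs (λ z → g z * δ z x))    ≡⟨ ∑-comm xs zs (λ x z → g z * δ z x) ⟩
      ∑ zs (λ z → ∑ xs (λ x → g z * δ z x))    ≡⟨ ∑-cong zs (λ z → ∑-*ˡ xs (g z) (δ z)) ⟩
      ∑ zs (λ z → g z * ∑ xs (δ z))            ≡⟨ ∑-cong-∈ zs (λ {z} z∈zs → cong (g z *_) (∑-δˡ z∈zs)) ⟩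
      ∑ zs (λ z → g z * 1ℚ)                    ≡⟨ ∑-cong zs (λ z → *-identityʳ (g z)) ⟩
      ∑ zs g                                   ∎
      where
      expand : ∀ x → g x ≡ ∑ zs (λ z → g z * δ z x)
      expand x with x ∈? zs
      ... | yes x∈zs = ≡.sym (∑-δ zs x g !zs x∈zs)
      ... | no  x∉zs = trans (g-vanishes x∉zs) (≡.sym (∑-δ-∉ zs g x∉zs))
      ∑-δˡ : ∀ {z} → z ∈ zs → ∑ xs (δ z) ≡ 1ℚ
      ∑-δˡ {z} z∈zs = trans (∑-cong xs (λ x → trans (δ-sym z x) (≡.sym (*-identityˡ (δ x z)))))
                            (∑-δ xs z (λ _ → 1ℚ) !xs (zs⊆xs z∈zs))

    ∑∑-δ : ∀ (xs : List A) (M : A → A → ℚ) {u v} → Unique xs → u ∈ xs → v ∈ xs →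
           ∑ xs (λ a → ∑ xs (λ b → M a b * (δ a u * δ b v))) ≡ M u v
    ∑∑-δ xs M {u} {v} !xs u∈xs v∈xs = begin
      ∑ xs (λ a → ∑ xs (λ b → M a b * (δ a u * δ b v)))
        ≡⟨ ∑-cong xs (λ a → ∑-cong xs (λ b → *-assoc (M a b) _ _)) ⟨
      ∑ xs (λ a → ∑ xs (λ b → (M a b * δ a u) * δ b v))
        ≡⟨ ∑-cong xs (λ a → ∑-δ xs v (λ b → M a b * δ a u) !xs v∈xs) ⟩
      ∑ xs (λ a → M a v * δ a u)
        ≡⟨ ∑-δ xs u (λ a → M a v) !xs u∈xs ⟩
      M u v ∎

    ∑∑-δ-unordered : ∀ (xs : List A) (M : A → A → ℚ) {u v} → Unique xs → u ∈ xs → v ∈ xs →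
      ∑ xs (λ a → ∑ xs (λ b → M a b * (δ a u * δ b v + δ a v * δ b u))) ≡ M u v + M v u
    ∑∑-δ-unordered xs M {u} {v} !xs u∈xs v∈xs = begin
      ∑ xs (λ a → ∑ xs (λ b → M a b * (δ a u * δ b v + δ a v * δ b u)))
        ≡⟨ ∑-cong xs (λ a → ∑-cong xs (λ b → *-distribˡ-+ (M a b) _ _)) ⟩
      ∑ xs (λ a → ∑ xs (λ b → M a b * (δ a u * δ b v) + M a b * (δ a v * δ b u)))
        ≡⟨ ∑-cong xs (λ a → ∑-+ xs _ _) ⟩
      ∑ xs (λ a → ∑ xs (λ b → M a b * (δ a u * δ b v)) + ∑ xs (λ b → M a b * (δ a v * δ b u)))
        ≡⟨ ∑-+ xs _ _ ⟩
      ∑ xs (λ a → ∑ xs (λ b → M a b * (δ a u * δ b v))) + ∑ xs (λ a → ∑ xs (λ b → M a b * (δ a v * δ b u)))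
        ≡⟨ cong₂ _+_ (∑∑-δ xs M !xs u∈xs v∈xs) (∑∑-δ xs M !xs v∈xs u∈xs) ⟩
      M u v + M v u ∎

module ListLemmas where

  open import Data.Fin using (zero; suc)
  open import Data.List using (List; _∷_; lookup)
  open import Data.List.Membership.Propositional using (_∈_)
  open import Data.List.Membership.Propositional.Properties using (∈-lookup)
  open import Data.List.Relation.Unary.Any using (here; there)
  import Data.List.Relation.Unary.All as All
  open import Data.List.Relation.Unary.AllPairs using (AllPairs; _∷_)
  open import Data.List.Relation.Unary.Unique.Propositional using (Unique)
  open import Data.Sum using (_⊎_; inj₁; inj₂)
  open import Data.Empty using (⊥-elim)
  open import Relation.Binary.PropositionalEquality as ≡ using (_≡_; refl; cong)

  module _ {a} {A : Set a} where

    AllPairs-related : ∀ {r} {R : A → A → Set r} {xs x y} →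
                       AllPairs R xs → x ∈ xs → y ∈ xs → x ≡ y ⊎ R x y ⊎ R y x
    AllPairs-related (_  ∷ _)   (here refl) (here refl) = inj₁ refl
    AllPairs-related (Rx ∷ _)   (here refl) (there y∈)  = inj₂ (inj₁ (All.lookup Rx y∈))
    AllPairs-related (Rx ∷ _)   (there x∈)  (here refl) = inj₂ (inj₂ (All.lookup Rx x∈))
    AllPairs-related (_  ∷ Rxs) (there x∈)  (there y∈)  = AllPairs-related Rxs x∈ y∈

    Unique-lookup-injective : ∀ {xs : List A} → Unique xs → ∀ i j → lookup xs i ≡ lookup xs j → i ≡ j
    Unique-lookup-injective (_   ∷ _)   zero    zero    _  = refl
    Unique-lookup-injective (x∉ ∷ _)   zero    (suc j) eq = ⊥-elim (All.lookup x∉ (∈-lookup j) eq)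
    Unique-lookup-injective (x∉ ∷ _)   (suc i) zero    eq = ⊥-elim (All.lookup x∉ (∈-lookup i) (≡.sym eq))
    Unique-lookup-injective (_   ∷ !xs) (suc i) (suc j) eq = cong suc (Unique-lookup-injective !xs i j eq)

module FinSubset where

  open import Data.Nat using (ℕ; zero; suc; _≤_; _<_)
  open import Data.Nat.Properties using (<⇒≱)
  open import Data.Fin using (Fin; zero; suc)
  open import Data.Fin.Properties using (any?)
  open import Data.Fin.Subset using (Subset; ⁅_⁆; _∪_; ∣_∣; _∈_; _∉_; _⊆_; inside; outside)
  open import Data.Fin.Subset.Properties
  open import Data.Vec using (_∷_; here; there)
  open import Data.List using (List; []; _∷_; length)
  import Data.List.Membership.Propositional as List
  open import Data.List.Relation.Unary.Any using (here; there)
  open import Data.List.Relation.Unary.All using (lookup)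
  open import Data.List.Relation.Unary.Unique.Propositional using (Unique)
  open import Data.List.Relation.Unary.AllPairs using ([]; _∷_)
  open import Data.Product using (∃; _×_; _,_)
  open import Data.Sum using (_⊎_; inj₁; inj₂)
  open import Data.Empty using (⊥-elim)
  open import Relation.Nullary using (¬_; yes; no)
  open import Relation.Nullary.Decidable using (_×-dec_; ¬?; decidable-stable)
  open import Relation.Binary.PropositionalEquality using (_≡_; refl; cong; trans)

  ∣⁅x⁆∪s∣ : ∀ {n} (x : Fin n) (s : Subset n) → x ∉ s → ∣ ⁅ x ⁆ ∪ s ∣ ≡ suc ∣ s ∣
  ∣⁅x⁆∪s∣ zero    (inside  ∷ s) x∉s = ⊥-elim (x∉s here)
  ∣⁅x⁆∪s∣ zero    (outside ∷ s) x∉s = cong (λ t → suc ∣ t ∣) (∪-identityˡ s)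
  ∣⁅x⁆∪s∣ (suc x) (inside  ∷ s) x∉s = cong suc (∣⁅x⁆∪s∣ x s (λ x∈s → x∉s (there x∈s)))
  ∣⁅x⁆∪s∣ (suc x) (outside ∷ s) x∉s = ∣⁅x⁆∪s∣ x s (λ x∈s → x∉s (there x∈s))

  module _ {n : ℕ} where

    ∈-⁅⁆∪⁻ : ∀ {x y : Fin n} {s} → x ∈ ⁅ y ⁆ ∪ s → x ≡ y ⊎ x ∈ s
    ∈-⁅⁆∪⁻ {y = y} {s} x∈ with x∈p∪q⁻ ⁅ y ⁆ s x∈
    ... | inj₁ x∈⁅y⁆ = inj₁ (x∈⁅y⁆⇒x≡y y x∈⁅y⁆)
    ... | inj₂ x∈s   = inj₂ x∈s

    ∈-⁅⁆∪ˡ : ∀ {y : Fin n} {s} → y ∈ ⁅ y ⁆ ∪ s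
    ∈-⁅⁆∪ˡ {y} = x∈p∪q⁺ (inj₁ (x∈⁅x⁆ y))

    ∈-⁅⁆∪ʳ : ∀ {x y : Fin n} {s} → x ∈ s → x ∈ ⁅ y ⁆ ∪ s
    ∈-⁅⁆∪ʳ {y = y} x∈s = x∈p∪q⁺ {p = ⁅ y ⁆} (inj₂ x∈s)

    ⊆-or-∃∉ : ∀ (p q : Subset n) → q ⊆ p ⊎ ∃ λ x → x ∈ q × x ∉ p
    ⊆-or-∃∉ p q with any? (λ x → (x ∈? q) ×-dec ¬? (x ∈? p))
    ... | yes witness = inj₂ witness
    ... | no  ∄x      = inj₁ (λ {x} x∈q → decidable-stable (x ∈? p) (λ x∉p → ∄x (x , x∈q , x∉p)))

    ⊆-∣∣-antisym : ∀ {p q : Subset n} → p ⊆ q → ∣ q ∣ ≤ ∣ p ∣ → p ≡ q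
    ⊆-∣∣-antisym {p} {q} p⊆q ∣q∣≤∣p∣ with ⊆-or-∃∉ p q
    ... | inj₁ q⊆p               = ⊆-antisym p⊆q q⊆p
    ... | inj₂ (x , x∈q , x∉p) = ⊥-elim (<⇒≱ (p⊂q⇒∣p∣<∣q∣ (p⊆q , x , x∈q , x∉p)) ∣q∣≤∣p∣)

    ⊆-∣∣-<⇒∃∉ : ∀ {p q : Subset n} → p ⊆ q → ∣ p ∣ < ∣ q ∣ → ∃ λ x → x ∈ q × x ∉ p
    ⊆-∣∣-<⇒∃∉ {p} {q} p⊆q ∣p∣<∣q∣ with ⊆-or-∃∉ p q
    ... | inj₁ q⊆p    = ⊥-elim (<⇒≱ ∣p∣<∣q∣ (p⊆q⇒∣p∣≤∣q∣ q⊆p))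
    ... | inj₂ witness = witness

  module _ {n : ℕ} (G : Graph n) where

    ∈-setOf⁻ : ∀ {x : Fin n} ys → x ∈ setOf G ys → x List.∈ ys
    ∈-setOf⁻ []       x∈ = ⊥-elim (∉⊥ x∈)
    ∈-setOf⁻ (y ∷ ys) x∈ with ∈-⁅⁆∪⁻ x∈
    ... | inj₁ refl = here refl
    ... | inj₂ x∈ys = there (∈-setOf⁻ ys x∈ys)

    ∈-setOf⁺ : ∀ {x : Fin n} ys → x List.∈ ys → x ∈ setOf G ys
    ∈-setOf⁺ (y ∷ ys) (here refl) = ∈-⁅⁆∪ˡ
    ∈-setOf⁺ (y ∷ ys) (there x∈)  = ∈-⁅⁆∪ʳ (∈-setOf⁺ ys x∈)

    ∣setOf∣ : ∀ (ys : List (Fin n)) → Unique ys → ∣ setOf G ys ∣ ≡ length ys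
    ∣setOf∣ []       _            = ∣⊥∣≡0 n
    ∣setOf∣ (y ∷ ys) (y∉ys ∷ uys) =
      trans (∣⁅x⁆∪s∣ y (setOf G ys) (λ y∈ → lookup y∉ys (∈-setOf⁻ ys y∈) refl)) (cong suc (∣setOf∣ ys uys))

module CliqueExtension {n : ℕ} (G : Graph n) where

  open import Data.Nat using (zero; suc; _<_; _≟_)
  open import Data.Nat.Properties using (≤-refl; ≤-reflexive)
  open import Data.Rational using (ℚ)
  open import Data.Fin using (Fin)
  open import Data.Fin.Subset using (Subset; ∣_∣; _∈_; _⊆_; inside; outside)
  open import Data.Fin.Subset.Properties using (_⊆?_)
  open import Data.Vec using ([]; _∷_; tail)
  open import Data.List using (List; []; _∷_; map; filter; concatMap; allFin; length)
  open import Data.List.Properties using (length-map)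
  import Data.List.Membership.Propositional as List
  open import Data.List.Membership.Propositional.Properties using (∈-filter⁺; ∈-filter⁻; ∈-map⁺; ∈-map⁻; ∈-allFin)
  open import Data.List.Membership.Propositional.Properties.WithK using (unique∧set⇒bag)
  open import Data.List.Relation.Binary.BagAndSetEquality using (∼bag⇒↭)
  open import Data.List.Relation.Binary.Permutation.Propositional using (_↭_)
  open import Data.List.Relation.Binary.Permutation.Propositional.Properties using (↭-length)
  open import Data.List.Relation.Unary.Any using (here; there)
  open import Data.List.Relation.Unary.All as All using (All; []; _∷_)
  open import Data.List.Relation.Unary.All.Properties using (all-filter)
  open import Data.List.Relation.Unary.AllPairs as AllPairs using ([]; _∷_)
  open import Data.List.Relation.Unary.Unique.Propositional using (Unique)
  import Data.List.Relation.Unary.Unique.Propositional.Properties as Unique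
  open import Data.Product using (_×_; _,_; proj₁; proj₂)
  open import Data.Sum using (inj₁; inj₂)
  open import Data.Empty using (⊥-elim)
  open import Function.Bundles using (mk⇔)
  open import Relation.Nullary using (¬_)
  open import Relation.Nullary.Decidable using (_×-dec_)
  open import Relation.Unary using (Decidable)
  open import Relation.Binary.PropositionalEquality as ≡ using (_≡_; refl; cong; subst; subst₂; trans)
  open FinSubset
  open ListSum
  open ListLemmas

  private
    extend : ∀ {m} → Subset m → List (Subset (suc m))
    extend s = (inside ∷ s) ∷ (outside ∷ s) ∷ []

    ∈-extend⁻ : ∀ {m} {y : Subset (suc m)} (xs : List (Subset m)) →
                y List.∈ concatMap extend xs → tail y List.∈ xs
    ∈-extend⁻ (s ∷ xs) (here refl)         = here refl
    ∈-extend⁻ (s ∷ xs) (there (here refl)) = here refl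
    ∈-extend⁻ (s ∷ xs) (there (there y∈))  = there (∈-extend⁻ xs y∈)

    ∈-extend⁺ : ∀ {m} (xs : List (Subset m)) b {s} → s List.∈ xs → (b ∷ s) List.∈ concatMap extend xs
    ∈-extend⁺ (t ∷ xs) inside  (here refl) = here refl
    ∈-extend⁺ (t ∷ xs) outside (here refl) = there (here refl)
    ∈-extend⁺ (t ∷ xs) b       (there s∈)  = there (there (∈-extend⁺ xs b s∈))

    unique-extend : ∀ {m} (xs : List (Subset m)) → Unique xs → Unique (concatMap extend xs)
    unique-extend []       []           = []
    unique-extend (s ∷ xs) (s∉xs ∷ uxs) = ((λ ()) ∷ fresh) ∷ fresh ∷ unique-extend xs uxs
      where
      fresh : ∀ {b} → All (λ y → ¬ b ∷ s ≡ y) (concatMap extend xs)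
      fresh = All.tabulate (λ y∈ eq → All.lookup s∉xs (∈-extend⁻ xs y∈) (cong tail eq))

  allSubsets-unique : ∀ m → Unique (allSubsets G m)
  allSubsets-unique zero    = [] ∷ []
  allSubsets-unique (suc m) = unique-extend (allSubsets G m) (allSubsets-unique m)

  allSubsets-complete : ∀ m (s : Subset m) → s List.∈ allSubsets G m
  allSubsets-complete zero    []      = here refl
  allSubsets-complete (suc m) (b ∷ s)     = ∈-extend⁺ (allSubsets G m) b (allSubsets-complete m s)

  Adj⇒≢ : ∀ {x y} → Adj G x y → ¬ x ≡ y
  Adj⇒≢ {x} x~y refl = irrefl G x~y

  edge-clique : ∀ {u v} → Adj G u v → IsOrderedClique G (u ∷ v ∷ [])
  edge-clique u~v = ((Adj⇒≢ u~v , u~v) ∷ []) ∷ [] ∷ []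

  AdjToAll : List (Fin n) → Fin n → Set
  AdjToAll vs x = All (λ v → Adj G v x) vs

  adjToAll? : (vs : List (Fin n)) → Decidable (AdjToAll vs)
  adjToAll? vs x = All.all? (λ v → adj? G v x) vs

  commonNeighbours : List (Fin n) → List (Fin n)
  commonNeighbours vs = filter (adjToAll? vs) (allFin n)

  ∈-commonNeighbours⁻ : ∀ {vs x} → x List.∈ commonNeighbours vs → AdjToAll vs x
  ∈-commonNeighbours⁻ {vs} x∈ = proj₂ (∈-filter⁻ (adjToAll? vs) {xs = allFin n} x∈)

  commonNeighbours-unique : ∀ vs → Unique (commonNeighbours vs)
  commonNeighbours-unique vs = Unique.filter⁺ (adjToAll? vs) (Unique.allFin⁺ n)

  AdjToAll⇒∉ : ∀ {vs x} → AdjToAll vs x → ¬ (x List.∈ vs)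
  AdjToAll⇒∉ (vx ∷ _)  (here refl) = irrefl G vx
  AdjToAll⇒∉ (_  ∷ vsx) (there x∈) = AdjToAll⇒∉ vsx x∈

  module Extension (vs : List (Fin n)) (vs-clique : IsOrderedClique G vs) where

    private
      S : Subset n
      S = setOf G vs

      add : Fin n → Subset n
      add x = setOf G (x ∷ vs)

      vs-unique : Unique vs
      vs-unique = AllPairs.map proj₁ vs-clique

      ∣add∣ : ∀ {x} → AdjToAll vs x → ∣ add x ∣ ≡ suc (length vs)
      ∣add∣ x~vs = ∣setOf∣ G (_ ∷ vs)
        (All.tabulate (λ v∈ x≡v → AdjToAll⇒∉ x~vs (subst (List._∈ vs) (≡.sym x≡v) v∈)) ∷ vs-unique)

      add-clique : ∀ {x} → AdjToAll vs x → IsCliqueSet G (add x)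
      add-clique {x} x~vs a b a∈ b∈
        with AllPairs-related {R = Adj G} (All.map (sym G) x~vs ∷ AllPairs.map proj₂ vs-clique)
                     (∈-setOf⁻ G (x ∷ vs) a∈) (∈-setOf⁻ G (x ∷ vs) b∈)
      ... | inj₁ a≡b        = inj₁ a≡b
      ... | inj₂ (inj₁ a~b) = inj₂ a~b
      ... | inj₂ (inj₂ b~a) = inj₂ (sym G b~a)

      add-injective : ∀ {x y} → AdjToAll vs x → add x ≡ add y → x ≡ y
      add-injective {x} x~vs eq with ∈-⁅⁆∪⁻ {s = S} (subst (x ∈_) eq ∈-⁅⁆∪ˡ)
      ... | inj₁ x≡y = x≡y
      ... | inj₂ x∈S = ⊥-elim (AdjToAll⇒∉ x~vs (∈-setOf⁻ G vs x∈S))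

      K : List (Subset n)
      K = 𝒦 G (suc (length vs)) S

      P? : Decidable (λ T → ∣ T ∣ ≡ suc (length vs) × S ⊆ T × IsCliqueSet G T)
      P? T = (∣ T ∣ ≟ suc (length vs)) ×-dec (S ⊆? T) ×-dec isCliqueSet? G T

      ∈-K⇒∈-add : ∀ {T} → T List.∈ K → T List.∈ map add (commonNeighbours vs)
      ∈-K⇒∈-add {T} T∈K with ∈-filter⁻ P? {xs = allSubsets G n} T∈K
      ... | _ , ∣T∣≡ , S⊆T , T-clique
          with ⊆-∣∣-<⇒∃∉ S⊆T (subst₂ _<_ (≡.sym (∣setOf∣ G vs vs-unique)) (≡.sym ∣T∣≡) ≤-refl)
      ... | x , x∈T , x∉S = subst (List._∈ map add (commonNeighbours vs)) add-x≡T
                                  (∈-map⁺ add (∈-filter⁺ (adjToAll? vs) (∈-allFin x) x~vs))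
        where
        x~vs : AdjToAll vs x
        x~vs = All.tabulate v~x
          where
          v~x : ∀ {v} → v List.∈ vs → Adj G v x
          v~x {v} v∈ with T-clique v x (S⊆T (∈-setOf⁺ G vs v∈)) x∈T
          ... | inj₁ refl = ⊥-elim (x∉S (∈-setOf⁺ G vs v∈))
          ... | inj₂ v~x  = v~x
        add-x⊆T : add x ⊆ T
        add-x⊆T y∈ with ∈-⁅⁆∪⁻ {s = S} y∈
        ... | inj₁ refl = x∈T
        ... | inj₂ y∈S  = S⊆T y∈S
        add-x≡T : add x ≡ T
        add-x≡T = ⊆-∣∣-antisym add-x⊆T (≤-reflexive (trans ∣T∣≡ (≡.sym (∣add∣ x~vs))))

      ∈-add⇒∈-K : ∀ {T} → T List.∈ map add (commonNeighbours vs) → T List.∈ K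
      ∈-add⇒∈-K T∈ with ∈-map⁻ add T∈
      ... | x , x∈N , refl = ∈-filter⁺ P? (allSubsets-complete n (add x)) (∣add∣ x~vs , ∈-⁅⁆∪ʳ , add-clique x~vs)
        where x~vs = ∈-commonNeighbours⁻ x∈N

      unique-map-add : ∀ {xs} → All (AdjToAll vs) xs → Unique xs → Unique (map add xs)
      unique-map-add []           []           = []
      unique-map-add (x~vs ∷ xs~vs) (x∉xs ∷ uxs) =
        All.map⁺ (All.tabulate (λ y∈ eq → All.lookup x∉xs y∈ (add-injective x~vs eq))) ∷ unique-map-add xs~vs uxs
        where import Data.List.Relation.Unary.All.Properties as All

      𝒦-extension-↭ : 𝒦 G (suc (length vs)) (setOf G vs) ↭ map add (commonNeighbours vs)
      𝒦-extension-↭ = ∼bag⇒↭ (unique∧set⇒bag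
        (Unique.filter⁺ P? (allSubsets-unique n))
        (unique-map-add (all-filter (adjToAll? vs) (allFin n)) (commonNeighbours-unique vs))
        (mk⇔ ∈-K⇒∈-add ∈-add⇒∈-K))

    length-𝒦-extension : length (𝒦 G (suc (length vs)) (setOf G vs)) ≡ length (commonNeighbours vs)
    length-𝒦-extension = trans (↭-length 𝒦-extension-↭) (length-map add (commonNeighbours vs))

    ∑-𝒦-extension : ∀ (f : Subset n → ℚ) →
                    ∑ (𝒦 G (suc (length vs)) (setOf G vs)) f ≡ ∑ (commonNeighbours vs) (λ x → f (setOf G (x ∷ vs)))
    ∑-𝒦-extension f = trans (∑-↭ f 𝒦-extension-↭) (∑-map add (commonNeighbours vs) f)

module MinimumDegree where

  open import Data.Nat
  open import Data.Nat.Properties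
  open import Data.Nat.Tactic.RingSolver using (solve-∀)
  open import Data.List using ([]; _∷_; length; filter; allFin)
  open import Data.List.Properties using (length-tabulate; filter-all)
  open import Data.List.Relation.Unary.All as All using ([])
  open import Data.Bool using (true; false; _∧_)
  open import Relation.Nullary using (does)
  open import Relation.Unary using (Decidable)
  open import Relation.Binary.PropositionalEquality as ≡ using (_≡_; refl; cong; subst; subst₂)
  open import Data.Empty using (⊥-elim)
  open ≤-Reasoning

  private
    +-suc-mono : ∀ {a b c l} → a + b ≤ c + l → a + suc b ≤ c + suc l
    +-suc-mono {a} {b} {c} {l} h = subst₂ _≤_ (≡.sym (+-suc a b)) (≡.sym (+-suc c l)) (s≤s h)

    ≤-+-suc : ∀ {a c l} → a ≤ suc (c + l) → a ≤ c + suc l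
    ≤-+-suc {a} {c} {l} = subst (a ≤_) (≡.sym (+-suc c l))

  -- |P ∩ Q| ≥ |P| + |Q| − |xs|, stated without truncated subtraction.
  length-filter-∧ : ∀ {a p q r} {A : Set a} {P : A → Set p} {Q : A → Set q} {R : A → Set r}
    (P? : Decidable P) (Q? : Decidable Q) (R? : Decidable R) →
    (∀ x → does (R? x) ≡ does (P? x) ∧ does (Q? x)) → ∀ xs →
    length (filter P? xs) + length (filter Q? xs) ≤ length (filter R? xs) + length xs
  length-filter-∧ P? Q? R? R≡P∧Q [] = z≤n
  length-filter-∧ P? Q? R? R≡P∧Q (x ∷ xs)
    with does (P? x) | does (Q? x) | does (R? x) | R≡P∧Q x | length-filter-∧ P? Q? R? R≡P∧Q xs
  ... | true  | true  | true  | _ | ih = s≤s (+-suc-mono ih)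
  ... | true  | false | false | _ | ih = ≤-+-suc (s≤s ih)
  ... | false | true  | false | _ | ih = +-suc-mono ih
  ... | false | false | false | _ | ih = ≤-+-suc (m≤n⇒m≤1+n ih)

  MinDegree>¾ : ∀ {n} → Graph n → Set
  MinDegree>¾ {n} G = ∀ v → 3 * n < 4 * degree G v

  module _ {n : ℕ} (G : Graph n) (3n<4δ : MinDegree>¾ G) where

    open CliqueExtension G

    length-commonNeighbours-[] : length (commonNeighbours []) ≡ n
    length-commonNeighbours-[] = ≡.trans
      (cong length (filter-all (adjToAll? []) {xs = allFin n} (All.tabulate (λ _ → []))))
      (length-tabulate {n = n} (λ x → x))

    length-commonNeighbours-∷ : ∀ w vs →
      degree G w + length (commonNeighbours vs) ≤ length (commonNeighbours (w ∷ vs)) + n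
    length-commonNeighbours-∷ w vs =
      subst (λ k → degree G w + length (commonNeighbours vs) ≤ length (commonNeighbours (w ∷ vs)) + k)
            (length-tabulate (λ x → x))
            (length-filter-∧ (adj? G w) (adjToAll? vs) (adjToAll? (w ∷ vs)) (λ _ → refl) (allFin n))

    -- Each further vertex costs fewer than n/4 common neighbours.
    length-commonNeighbours-≥ : ∀ vs →
      4 * n + length vs ≤ 4 * length (commonNeighbours vs) + length vs * n
    length-commonNeighbours-≥ [] = subst (λ k → 4 * n + 0 ≤ 4 * k + 0) (≡.sym length-commonNeighbours-[]) ≤-refl
    length-commonNeighbours-≥ (w ∷ vs) = +-cancelʳ-≤ (3 * n) _ _ (begin
      (4 * n + suc k) + 3 * n       ≡⟨ shuffle₁ n k ⟩
      (4 * n + k) + suc (3 * n)     ≤⟨ +-mono-≤ (length-commonNeighbours-≥ vs) (3n<4δ w) ⟩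
      (4 * c + k * n) + 4 * d       ≡⟨ shuffle₂ d c k n ⟩
      4 * (d + c) + k * n           ≤⟨ +-monoˡ-≤ (k * n) (*-monoʳ-≤ 4 (length-commonNeighbours-∷ w vs)) ⟩
      4 * (c′ + n) + k * n          ≡⟨ shuffle₃ c′ k n ⟩
      (4 * c′ + suc k * n) + 3 * n  ∎)
      where
      k = length vs
      c = length (commonNeighbours vs)
      c′ = length (commonNeighbours (w ∷ vs))
      d = degree G w
      shuffle₁ : ∀ n k → (4 * n + suc k) + 3 * n ≡ (4 * n + k) + suc (3 * n)
      shuffle₁ = solve-∀
      shuffle₂ : ∀ d c k n → (4 * c + k * n) + 4 * d ≡ 4 * (d + c) + k * n
      shuffle₂ = solve-∀
      shuffle₃ : ∀ c′ k n → 4 * (c′ + n) + k * n ≡ (4 * c′ + suc k * n) + 3 * n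
      shuffle₃ = solve-∀

    commonNeighbours-nonempty : ∀ vs → 1 ≤ length vs → length vs ≤ 4 → 1 ≤ length (commonNeighbours vs)
    commonNeighbours-nonempty vs 1≤k k≤4 with length (commonNeighbours vs) | length-commonNeighbours-≥ vs
    ... | suc _ | _     = s≤s z≤n
    ... | zero  | bound = ⊥-elim (<⇒≱ (+-monoʳ-< (4 * n) 1≤k) (begin
      4 * n + length vs  ≤⟨ bound ⟩
      length vs * n      ≤⟨ *-monoˡ-≤ n k≤4 ⟩
      4 * n              ≡⟨ +-identityʳ (4 * n) ⟨
      4 * n + 0          ∎))

module EdgeGadget {n : ℕ} (G : Graph n) where

  open import Data.Nat using (zero; suc) renaming (_+_ to _+ℕ_)
  open import Data.Integer using (+_; -[1+_])
  open import Data.Rational as ℚ using (ℚ; _/_; _+_; _*_; 0ℚ)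
  open import Data.Rational.Properties using (*-zeroʳ; *-zeroˡ)
  open import Data.Fin using (Fin; zero; suc; _≟_)
  open import Data.Fin.Properties using (all?)
  open import Data.Fin.Subset using (⁅_⁆; _∪_; _∈_; _⊆_)
  open import Data.Fin.Subset.Properties using (_∈?_; _⊆?_; ∪-identityʳ)
  open import Data.List using (List; []; _∷_; map; allFin; lookup)
  import Data.List.Membership.Propositional as List
  open import Data.List.Membership.Propositional.Properties using (∈-map⁺; ∈-map⁻; ∈-allFin; ∈-lookup)
  import Data.List.Membership.DecPropositional as DecMembership
  open import Data.List.Relation.Unary.Any as Any using (here; there)
  open import Data.List.Relation.Unary.Any.Properties using (lookup-index)
  open import Data.List.Relation.Unary.All as All using (All; []; _∷_)
  import Data.List.Relation.Unary.All.Properties as All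
  open import Data.List.Relation.Unary.AllPairs as AllPairs using ([]; _∷_)
  open import Data.List.Relation.Unary.Unique.Propositional using (Unique)
  import Data.List.Relation.Unary.Unique.Propositional.Properties as Unique
  open import Data.Product using (_,_; proj₁; proj₂)
  open import Data.Sum using (inj₁; inj₂)
  open import Data.Bool using (true; false; if_then_else_)
  open import Data.Empty using (⊥-elim)
  open import Function.Bundles using (_⇔_; mk⇔)
  open import Relation.Nullary using (¬_; Dec; yes; no; does)
  open import Relation.Nullary.Decidable using (does-⇔; dec-true; dec-false; ¬?; _→-dec_; toWitness)
  open import Relation.Binary.PropositionalEquality as ≡ using (_≡_; refl; cong; cong₂; subst; trans)
  open ≡.≡-Reasoning
  open ListSum
  open ListLemmas
  open FinSubset
  open CliqueExtension G
  open KroneckerDelta (_≟_ {n})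

  gadgetValue : ℕ → ℚ
  gadgetValue 1 = -[1+ 0 ] / 6
  gadgetValue _ = + 1 / 3

  edgeGadget-≡ : ∀ S a b T → edgeGadget G S a b T ≡ (if does (T ⊆? S) then gadgetValue (meet G a b T) else 0ℚ)
  edgeGadget-≡ S a b T with does (T ⊆? S) | meet G a b T
  ... | false | _             = refl
  ... | true  | zero          = refl
  ... | true  | suc zero      = refl
  ... | true  | suc (suc _)   = refl

  open KroneckerDelta (_≟_ {5}) using () renaming (δ to δ₅)
  open DecMembership (_≟_ {5}) using () renaming (_∈?_ to _∈₅?_)

  hits : Fin 5 → List (Fin 5) → ℕ
  hits p zs = if does (p ∈₅? zs) then 1 else 0

  -- The summand for x = κ l of ∑_{x ∈ N(u,v)} ψ_K({x,u,v}) when u = κ i and v = κ j.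
  entry : Fin 5 → Fin 5 → Fin 5 → ℚ
  entry i j l = if does (All.all? (λ z → ¬? (z ≟ l)) (i ∷ j ∷ []))
                then gadgetValue (hits zero (l ∷ i ∷ j ∷ []) +ℕ hits (suc zero) (l ∷ i ∷ j ∷ []))
                else 0ℚ

  -- A check of the 20 pairs i ≢ j, carried out by evaluation.
  ∑-entry : ∀ i j → ¬ i ≡ j → ∑ (allFin 5) (entry i j) ≡ δ₅ zero i * δ₅ (suc zero) j + δ₅ zero j * δ₅ (suc zero) i
  ∑-entry = toWitness {a? = all? λ i → all? λ j → ¬? (i ≟ j) →-dec
    (∑ (allFin 5) (entry i j) ℚ.≟ (δ₅ zero i * δ₅ (suc zero) j + δ₅ zero j * δ₅ (suc zero) i))} _

  -- Equality and adjacency of the vertices a,…,e of K do not compute, but those of their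
  -- indices in Fin 5 do; so the sum is transported along κ = lookup K to a table over Fin 5.
  module _ (a b c d e : Fin n) (K-clique : IsOrderedClique G (a ∷ b ∷ c ∷ d ∷ e ∷ [])) where

    private
      K : List (Fin n)
      K = a ∷ b ∷ c ∷ d ∷ e ∷ []

      κ : Fin 5 → Fin n
      κ = lookup K

      K-unique : Unique K
      K-unique = AllPairs.map proj₁ K-clique

      κ-injective : ∀ {i j} → κ i ≡ κ j → i ≡ j
      κ-injective = Unique-lookup-injective K-unique _ _

      κ-adjacent : ∀ {i j} → ¬ i ≡ j → Adj G (κ i) (κ j)
      κ-adjacent {i} {j} i≢j with AllPairs-related K-clique (∈-lookup {xs = K} i) (∈-lookup {xs = K} j)
      ... | inj₁ κi≡κj        = ⊥-elim (i≢j (κ-injective κi≡κj))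
      ... | inj₂ (inj₁ κi~κj) = proj₂ κi~κj
      ... | inj₂ (inj₂ κj~κi) = sym G (proj₂ κj~κi)

      δ-κ : ∀ p q → δ (κ p) (κ q) ≡ δ₅ p q
      δ-κ p q = cong 𝟙 (does-⇔ (mk⇔ κ-injective (cong κ)) (κ p ≟ κ q) (p ≟ q))

      ∈-setOf-κ : ∀ p zs → κ p ∈ setOf G (map κ zs) ⇔ p List.∈ zs
      ∈-setOf-κ p zs = mk⇔ to (λ p∈zs → ∈-setOf⁺ G (map κ zs) (∈-map⁺ κ p∈zs))
        where
        to : κ p ∈ setOf G (map κ zs) → p List.∈ zs
        to κp∈ with ∈-map⁻ κ (∈-setOf⁻ G (map κ zs) κp∈)
        ... | z , z∈zs , κp≡κz = subst (List._∈ zs) (≡.sym (κ-injective κp≡κz)) z∈zs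

      AdjToAll-κ : ∀ l zs → AdjToAll (map κ zs) (κ l) ⇔ All (λ z → ¬ z ≡ l) zs
      AdjToAll-κ l zs = mk⇔
        (λ κzs~κl → All.map (λ κz~κl z≡l → Adj⇒≢ κz~κl (cong κ z≡l)) (All.map⁻ κzs~κl))
        (λ zs≢l → All.map⁺ (All.map κ-adjacent zs≢l))

      setOf-κ-⊆ : ∀ zs → setOf G (map κ zs) ⊆ setOf G K
      setOf-κ-⊆ zs y∈ with ∈-map⁻ κ (∈-setOf⁻ G (map κ zs) y∈)
      ... | z , _ , refl = ∈-setOf⁺ G K (∈-lookup {xs = K} z)

      ψ-κ : ∀ i j l → ψ G K (setOf G (κ l ∷ κ i ∷ κ j ∷ []))
                      ≡ gadgetValue (hits zero (l ∷ i ∷ j ∷ []) +ℕ hits (suc zero) (l ∷ i ∷ j ∷ []))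
      ψ-κ i j l = begin
        edgeGadget G (setOf G K) a b T
          ≡⟨ edgeGadget-≡ (setOf G K) a b T ⟩
        (if does (T ⊆? setOf G K) then gadgetValue (meet G a b T) else 0ℚ)
          ≡⟨ cong (λ t → if t then gadgetValue (meet G a b T) else 0ℚ) (dec-true (T ⊆? setOf G K) (setOf-κ-⊆ zs)) ⟩
        gadgetValue (meet G a b T)
          ≡⟨ cong gadgetValue (cong₂ _+ℕ_ (cong (λ t → if t then 1 else 0) (does-κ zero))
                                          (cong (λ t → if t then 1 else 0) (does-κ (suc zero)))) ⟩
        gadgetValue (hits zero zs +ℕ hits (suc zero) zs) ∎
        where
        zs = l ∷ i ∷ j ∷ []
        T = setOf G (map κ zs)
        does-κ : ∀ p → does (κ p ∈? T) ≡ does (p ∈₅? zs)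
        does-κ p = does-⇔ (∈-setOf-κ p zs) (κ p ∈? T) (p ∈₅? zs)

      ψ-outside : ∀ {y T} → y ∈ T → ¬ y List.∈ K → ψ G K T ≡ 0ℚ
      ψ-outside {y} {T} y∈T y∉K = trans (edgeGadget-≡ (setOf G K) a b T)
        (cong (λ t → if t then gadgetValue (meet G a b T) else 0ℚ)
              (dec-false (T ⊆? setOf G K) (λ T⊆K → y∉K (∈-setOf⁻ G K (T⊆K y∈T)))))

      δ-∉K : ∀ {x w} → x List.∈ K → ¬ w List.∈ K → δ x w ≡ 0ℚ
      δ-∉K x∈K w∉K = δ-≢ (λ x≡w → w∉K (subst (List._∈ K) x≡w x∈K))

      ∑-triangles-κ : ∀ i j → Adj G (κ i) (κ j) →
        ∑ (commonNeighbours (κ i ∷ κ j ∷ [])) (λ x → ψ G K (setOf G (x ∷ κ i ∷ κ j ∷ [])))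
          ≡ δ a (κ i) * δ b (κ j) + δ a (κ j) * δ b (κ i)
      ∑-triangles-κ i j κi~κj = begin
        ∑ (commonNeighbours (κ i ∷ κ j ∷ [])) (λ x → ψ G K (setOf G (x ∷ κ i ∷ κ j ∷ [])))
          ≡⟨ ∑-filter (adjToAll? (κ i ∷ κ j ∷ [])) (allFin n) (λ x → ψ G K (setOf G (x ∷ κ i ∷ κ j ∷ []))) ⟩
        ∑ (allFin n) g
          ≡⟨ ∑-supported (allFin n) K g (Unique.allFin⁺ n) K-unique (λ _ → ∈-allFin _) g-outside ⟩
        ∑ (map κ (allFin 5)) g
          ≡⟨ ∑-map κ (allFin 5) g ⟩
        ∑ (allFin 5) (λ l → g (κ l))
          ≡⟨ ∑-cong (allFin 5) g-κ ⟩
        ∑ (allFin 5) (entry i j)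
          ≡⟨ ∑-entry i j (λ i≡j → Adj⇒≢ κi~κj (cong κ i≡j)) ⟩
        δ₅ zero i * δ₅ (suc zero) j + δ₅ zero j * δ₅ (suc zero) i
          ≡⟨ cong₂ _+_ (cong₂ _*_ (δ-κ zero i) (δ-κ (suc zero) j)) (cong₂ _*_ (δ-κ zero j) (δ-κ (suc zero) i)) ⟨
        δ a (κ i) * δ b (κ j) + δ a (κ j) * δ b (κ i) ∎
        where
        g : Fin n → ℚ
        g x = if does (adjToAll? (κ i ∷ κ j ∷ []) x) then ψ G K (setOf G (x ∷ κ i ∷ κ j ∷ [])) else 0ℚ
        g-outside : ∀ {x} → ¬ x List.∈ K → g x ≡ 0ℚ
        g-outside {x} x∉K with does (adjToAll? (κ i ∷ κ j ∷ []) x)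
        ... | true  = ψ-outside ∈-⁅⁆∪ˡ x∉K
        ... | false = refl
        g-κ : ∀ l → g (κ l) ≡ entry i j l
        g-κ l = cong₂ (λ t y → if t then y else 0ℚ)
          (does-⇔ (AdjToAll-κ l (i ∷ j ∷ [])) (adjToAll? (κ i ∷ κ j ∷ []) (κ l)) (All.all? (λ z → ¬? (z ≟ l)) (i ∷ j ∷ [])))
          (ψ-κ i j l)

      ∑-triangles : ∀ {u v} → Adj G u v → Dec (u List.∈ K) → Dec (v List.∈ K) →
        ∑ (commonNeighbours (u ∷ v ∷ [])) (λ x → ψ G K (setOf G (x ∷ u ∷ v ∷ [])))
          ≡ δ a u * δ b v + δ a v * δ b u
      ∑-triangles u~v (yes u∈K) (yes v∈K)
        with Any.index u∈K | lookup-index u∈K | Any.index v∈K | lookup-index v∈K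
      ... | i | refl | j | refl = ∑-triangles-κ i j u~v
      ∑-triangles {u} {v} u~v (no u∉K) _ = begin
        ∑ (commonNeighbours (u ∷ v ∷ [])) _    ≡⟨ ∑-zero (commonNeighbours _) (λ {x} _ → ψ-outside {T = T x} (∈-⁅⁆∪ʳ ∈-⁅⁆∪ˡ) u∉K) ⟩
        0ℚ                                     ≡⟨ cong₂ _+_ (*-zeroˡ (δ b v)) (*-zeroʳ (δ a v)) ⟨
        0ℚ * δ b v + δ a v * 0ℚ                ≡⟨ cong₂ _+_ (cong (_* δ b v) (δ-∉K (here refl) u∉K))
                                                            (cong (δ a v *_) (δ-∉K (there (here refl)) u∉K)) ⟨
        δ a u * δ b v + δ a v * δ b u          ∎
        where T = λ x → setOf G (x ∷ u ∷ v ∷ [])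
      ∑-triangles {u} {v} u~v (yes _) (no v∉K) = begin
        ∑ (commonNeighbours (u ∷ v ∷ [])) _    ≡⟨ ∑-zero (commonNeighbours _) (λ {x} _ → ψ-outside {T = T x} (∈-⁅⁆∪ʳ (∈-⁅⁆∪ʳ ∈-⁅⁆∪ˡ)) v∉K) ⟩
        0ℚ                                     ≡⟨ cong₂ _+_ (*-zeroʳ (δ a u)) (*-zeroˡ (δ b u)) ⟨
        δ a u * 0ℚ + 0ℚ * δ b u                ≡⟨ cong₂ _+_ (cong (δ a u *_) (δ-∉K (there (here refl)) v∉K))
                                                            (cong (_* δ b u) (δ-∉K (here refl) v∉K)) ⟨
        δ a u * δ b v + δ a v * δ b u          ∎
        where T = λ x → setOf G (x ∷ u ∷ v ∷ [])

    ∑-ψ-over-triangles : ∀ {u v} → Adj G u v →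
      ∑ (𝒦 G 3 (⁅ u ⁆ ∪ ⁅ v ⁆)) (ψ G K) ≡ δ a u * δ b v + δ a v * δ b u
    ∑-ψ-over-triangles {u} {v} u~v = begin
      ∑ (𝒦 G 3 (⁅ u ⁆ ∪ ⁅ v ⁆)) (ψ G K)
        ≡⟨ cong (λ S → ∑ (𝒦 G 3 (⁅ u ⁆ ∪ S)) (ψ G K)) (∪-identityʳ ⁅ v ⁆) ⟨
      ∑ (𝒦 G 3 (setOf G (u ∷ v ∷ []))) (ψ G K)
        ≡⟨ Extension.∑-𝒦-extension (u ∷ v ∷ []) (edge-clique u~v) (ψ G K) ⟩
      ∑ (commonNeighbours (u ∷ v ∷ [])) (λ x → ψ G K (setOf G (x ∷ u ∷ v ∷ [])))
        ≡⟨ ∑-triangles u~v (u ∈L? K) (v ∈L? K) ⟩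
      δ a u * δ b v + δ a v * δ b u ∎
      where open DecMembership (_≟_ {n}) using () renaming (_∈?_ to _∈L?_)

module Weights {n : ℕ} (G : Graph n) (3n<4δ : MinimumDegree.MinDegree>¾ G) where

  open import Data.Nat using (zero; suc; _≤_; s≤s; z≤n)
  open import Data.Rational using (ℚ; _/_; _+_; 0ℚ; 1ℚ) renaming (_*_ to _·_)
  open import Data.Rational.Properties using (+-identityʳ; *-zeroˡ)
  open import Data.Fin using (Fin; _≟_)
  open import Data.List using (List; []; _∷_; _++_; map; allFin; length; take)
  open import Data.List.Membership.Propositional using (_∈_)
  open import Data.List.Membership.Propositional.Properties using (∈-map⁻; ∈-concatMap⁻; ∈-allFin)
  import Data.List.Relation.Unary.Unique.Propositional.Properties as Unique
  open import Data.Integer using (+_)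
  open import Data.List.Relation.Unary.Any as Any using (here)
  open import Data.Fin.Subset using (Subset; ⁅_⁆; _∪_)
  open import Data.List.Relation.Unary.All as All using ([]; _∷_)
  import Data.List.Relation.Unary.All.Properties as All
  open import Data.List.Relation.Unary.AllPairs as AllPairs using ([]; _∷_; allPairs?)
  import Data.List.Relation.Unary.AllPairs.Properties as AllPairs
  open import Data.Product using (_,_; proj₂)
  open import Data.Bool using (if_then_else_)
  open import Relation.Nullary using (Dec; yes; no; does)
  open import Relation.Nullary.Decidable using (_×-dec_; ¬?; dec-true; dec-false)
  open import Relation.Binary.PropositionalEquality as ≡ using (_≡_; refl; cong; trans)
  open ≡.≡-Reasoning
  open ListSum
  open CliqueExtension G
  open MinimumDegree using (commonNeighbours-nonempty)

  ½ : ℚ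
  ½ = + 1 / 2

  isOrderedClique? : (K : List (Fin n)) → Dec (IsOrderedClique G K)
  isOrderedClique? = allPairs? (λ x y → ¬? (x ≟ y) ×-dec adj? G x y)

  whenClique : List (Fin n) → ℚ → ℚ
  whenClique K x = if does (isOrderedClique? K) then x else 0ℚ

  ∑-allTuples : ∀ r (f : List (Fin n) → ℚ) →
                ∑ (allTuples G (suc r)) f ≡ ∑ (allFin n) (λ x → ∑ (allTuples G r) (λ t → f (x ∷ t)))
  ∑-allTuples r f = trans (∑-concatMap (λ x → map (x ∷_) (allTuples G r)) (allFin n) f)
                          (∑-cong (allFin n) (λ x → ∑-map (x ∷_) (allTuples G r) f))

  allTuples-length : ∀ {r t} → t ∈ allTuples G r → length t ≡ r
  allTuples-length {zero}  (here refl) = refl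
  allTuples-length {suc r} t∈ with Any.satisfied (∈-concatMap⁻ (λ x → map (x ∷_) (allTuples G r)) {xs = allFin n} t∈)
  ... | x , t∈x∷ with ∈-map⁻ (x ∷_) t∈x∷
  ...   | t′ , t′∈ , refl = cong suc (allTuples-length t′∈)

  extend-clique : ∀ {vs x} → IsOrderedClique G vs → AdjToAll vs x → IsOrderedClique G (vs ++ x ∷ [])
  extend-clique vs-clique x~vs =
    AllPairs.++⁺ vs-clique ([] ∷ []) (All.map (λ v~x → (Adj⇒≢ v~x , v~x) ∷ []) x~vs)

  clique-prefix-AdjToAll : ∀ vs {x t} → IsOrderedClique G (vs ++ x ∷ t) → AdjToAll vs x
  clique-prefix-AdjToAll []       _                 = []
  clique-prefix-AdjToAll (v ∷ vs) (v-rest ∷ clique) =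
    proj₂ (All.head (All.++⁻ʳ vs v-rest)) ∷ clique-prefix-AdjToAll vs clique

  -- Only common neighbours of a clique can extend it.
  ∑-completions : ∀ vs r (f : List (Fin n) → ℚ) →
    ∑ (allTuples G (suc r)) (λ t → whenClique (vs ++ t) (f t))
      ≡ ∑ (commonNeighbours vs) (λ x → ∑ (allTuples G r) (λ t → whenClique (vs ++ x ∷ t) (f (x ∷ t))))
  ∑-completions vs r f = begin
    ∑ (allTuples G (suc r)) (λ t → F t)                                   ≡⟨ ∑-allTuples r F ⟩
    ∑ (allFin n) (λ x → ∑ (allTuples G r) (λ t → F (x ∷ t)))               ≡⟨ ∑-cong (allFin n) guard ⟩
    ∑ (allFin n) (λ x → if does (adjToAll? vs x) then ∑ (allTuples G r) (λ t → F (x ∷ t)) else 0ℚ)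
                                                                          ≡⟨ ∑-filter (adjToAll? vs) (allFin n) _ ⟨
    ∑ (commonNeighbours vs) (λ x → ∑ (allTuples G r) (λ t → F (x ∷ t)))   ∎
    where
    F : List (Fin n) → ℚ
    F t = whenClique (vs ++ t) (f t)
    guard : ∀ x → ∑ (allTuples G r) (λ t → F (x ∷ t))
                  ≡ (if does (adjToAll? vs x) then ∑ (allTuples G r) (λ t → F (x ∷ t)) else 0ℚ)
    guard x with adjToAll? vs x
    ... | yes _     = refl
    ... | no  x≁vs = ∑-zero (allTuples G r) (λ {t} _ →
      cong (λ b → if b then f (x ∷ t) else 0ℚ)
           (dec-false (isOrderedClique? (vs ++ x ∷ t)) (λ clique → x≁vs (clique-prefix-AdjToAll vs clique))))

  ∑-inv-length : ∀ {a} {A : Set a} (xs : List A) (c : ℚ) → 1 ≤ length xs → ∑ xs (λ _ → inv G (length xs) · c) ≡ c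
  ∑-inv-length xs c _ with length xs in len
  ... | suc m = ∑-average xs m c len

  ∑-extension-average : ∀ vs → IsOrderedClique G vs → 1 ≤ length vs → length vs ≤ 4 → ∀ c →
    ∑ (commonNeighbours vs) (λ _ → inv G (length (𝒦 G (suc (length vs)) (setOf G vs))) · c) ≡ c
  ∑-extension-average vs clique 1≤k k≤4 c = begin
    ∑ (commonNeighbours vs) (λ _ → inv G (length (𝒦 G (suc (length vs)) (setOf G vs))) · c)
      ≡⟨ cong (λ k → ∑ (commonNeighbours vs) (λ _ → inv G k · c)) (Extension.length-𝒦-extension vs clique) ⟩
    ∑ (commonNeighbours vs) (λ _ → inv G (length (commonNeighbours vs)) · c)
      ≡⟨ ∑-inv-length (commonNeighbours vs) c (commonNeighbours-nonempty G 3n<4δ vs 1≤k k≤4) ⟩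
    c ∎

  completionMass : Fin n → Fin n → ℚ
  completionMass a b = ∑ (allTuples G 3) (λ t → whenClique (a ∷ b ∷ t) (W G (take 4 (a ∷ b ∷ t))))

  completionMass≡1 : ∀ {u v} → Adj G u v → completionMass u v ≡ 1ℚ
  completionMass≡1 {u} {v} u~v = begin
    completionMass u v
      ≡⟨ ∑-completions (u ∷ v ∷ []) 2 (λ t → W G (take 4 (u ∷ v ∷ t))) ⟩
    ∑ (commonNeighbours uv) (λ c → ∑ (allTuples G 2) (λ t → whenClique (u ∷ v ∷ c ∷ t) (W G (take 4 (u ∷ v ∷ c ∷ t)))))
      ≡⟨ ∑-cong-∈ (commonNeighbours uv) (λ c∈ → ∑-completions-uvc (∈-commonNeighbours⁻ c∈)) ⟩
    ∑ (commonNeighbours uv) (λ _ → iA · 1ℚ)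
      ≡⟨ ∑-extension-average uv uv-clique (s≤s z≤n) (s≤s (s≤s z≤n)) 1ℚ ⟩
    1ℚ ∎
    where
    uv = u ∷ v ∷ []
    uv-clique = edge-clique u~v
    iA = inv G (length (𝒦 G 3 (setOf G uv)))
    iB = λ c → inv G (length (𝒦 G 4 (setOf G (u ∷ v ∷ c ∷ []))))
    iC = λ c d → inv G (length (𝒦 G 5 (setOf G (u ∷ v ∷ c ∷ d ∷ []))))

    ∑-completions-uvcd : ∀ {c d} → AdjToAll uv c → AdjToAll (u ∷ v ∷ c ∷ []) d →
      ∑ (allTuples G 1) (λ t → whenClique (u ∷ v ∷ c ∷ d ∷ t) (W G (u ∷ v ∷ c ∷ d ∷ [])))
        ≡ iA · (iB c · 1ℚ)
    ∑-completions-uvcd {c} {d} c~uv d~uvc = begin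
      ∑ (allTuples G 1) (λ t → whenClique (u ∷ v ∷ c ∷ d ∷ t) (W G (u ∷ v ∷ c ∷ d ∷ [])))
        ≡⟨ ∑-completions uvcd 0 (λ _ → W G uvcd) ⟩
      ∑ (commonNeighbours uvcd) (λ e → whenClique (u ∷ v ∷ c ∷ d ∷ e ∷ []) (W G uvcd) + 0ℚ)
        ≡⟨ ∑-cong-∈ (commonNeighbours uvcd) (λ e∈ → trans (+-identityʳ _)
             (cong (λ b → if b then W G uvcd else 0ℚ)
                   (dec-true (isOrderedClique? _) (extend-clique uvcd-clique (∈-commonNeighbours⁻ e∈))))) ⟩
      ∑ (commonNeighbours uvcd) (λ _ → iA · (iB c · (iC c d · 1ℚ)))
        ≡⟨ ∑-*ˡ (commonNeighbours uvcd) iA _ ⟩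
      iA · ∑ (commonNeighbours uvcd) (λ _ → iB c · (iC c d · 1ℚ))
        ≡⟨ cong (iA ·_) (∑-*ˡ (commonNeighbours uvcd) (iB c) _) ⟩
      iA · (iB c · ∑ (commonNeighbours uvcd) (λ _ → iC c d · 1ℚ))
        ≡⟨ cong (λ z → iA · (iB c · z)) (∑-extension-average uvcd uvcd-clique (s≤s z≤n) (s≤s (s≤s (s≤s (s≤s z≤n)))) 1ℚ) ⟩
      iA · (iB c · 1ℚ) ∎
      where
      uvcd = u ∷ v ∷ c ∷ d ∷ []
      uvcd-clique = extend-clique (extend-clique uv-clique c~uv) d~uvc

    ∑-completions-uvc : ∀ {c} → AdjToAll uv c →
      ∑ (allTuples G 2) (λ t → whenClique (u ∷ v ∷ c ∷ t) (W G (take 4 (u ∷ v ∷ c ∷ t))))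
        ≡ iA · 1ℚ
    ∑-completions-uvc {c} c~uv = begin
      ∑ (allTuples G 2) (λ t → whenClique (u ∷ v ∷ c ∷ t) (W G (take 4 (u ∷ v ∷ c ∷ t))))
        ≡⟨ ∑-completions uvc 1 (λ t → W G (take 4 (u ∷ v ∷ c ∷ t))) ⟩
      ∑ (commonNeighbours uvc) (λ d → ∑ (allTuples G 1) (λ t → whenClique (u ∷ v ∷ c ∷ d ∷ t) (W G (u ∷ v ∷ c ∷ d ∷ []))))
        ≡⟨ ∑-cong-∈ (commonNeighbours uvc) (λ d∈ → ∑-completions-uvcd c~uv (∈-commonNeighbours⁻ d∈)) ⟩
      ∑ (commonNeighbours uvc) (λ _ → iA · (iB c · 1ℚ))
        ≡⟨ ∑-*ˡ (commonNeighbours uvc) iA _ ⟩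
      iA · ∑ (commonNeighbours uvc) (λ _ → iB c · 1ℚ)
        ≡⟨ cong (iA ·_) (∑-extension-average uvc (extend-clique uv-clique c~uv) (s≤s z≤n) (s≤s (s≤s (s≤s z≤n))) 1ℚ) ⟩
      iA · 1ℚ ∎
      where
      uvc = u ∷ v ∷ c ∷ []

  module _ {u v : Fin n} (u~v : Adj G u v) where
    open KroneckerDelta (_≟_ {n})

    S₃ : List (Subset n)
    S₃ = 𝒦 G 3 (⁅ u ⁆ ∪ ⁅ v ⁆)

    ∑-completions-ψ : ∀ a b →
      ∑ (allTuples G 3) (λ t → whenClique (a ∷ b ∷ t) (W G (take 4 (a ∷ b ∷ t)) · ∑ S₃ (ψ G (a ∷ b ∷ t))))
        ≡ completionMass a b · (δ a u · δ b v + δ a v · δ b u)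
    ∑-completions-ψ a b = trans
      (∑-cong-∈ (allTuples G 3) (λ {t} t∈ → summand t (allTuples-length t∈) (isOrderedClique? (a ∷ b ∷ t))))
      (∑-*ʳ (allTuples G 3) (δ a u · δ b v + δ a v · δ b u) _)
      where
      ∑-ψ : ∀ t → length t ≡ 3 → IsOrderedClique G (a ∷ b ∷ t) →
        ∑ S₃ (ψ G (a ∷ b ∷ t)) ≡ δ a u · δ b v + δ a v · δ b u
      ∑-ψ (c ∷ d ∷ e ∷ []) refl clique = EdgeGadget.∑-ψ-over-triangles G a b c d e clique u~v
      summand : ∀ t → length t ≡ 3 → (clique? : Dec (IsOrderedClique G (a ∷ b ∷ t))) →
        (if does clique? then W G (take 4 (a ∷ b ∷ t)) · ∑ S₃ (ψ G (a ∷ b ∷ t)) else 0ℚ)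
          ≡ (if does clique? then W G (take 4 (a ∷ b ∷ t)) else 0ℚ) · (δ a u · δ b v + δ a v · δ b u)
      summand t len (yes clique) = cong (W G (take 4 (a ∷ b ∷ t)) ·_) (∑-ψ t len clique)
      summand t len (no _)       = ≡.sym (*-zeroˡ (δ a u · δ b v + δ a v · δ b u))

    ∑-w-over-triangles : ∑ S₃ (w G) ≡ ½ · (completionMass u v + completionMass v u)
    ∑-w-over-triangles = begin
      ∑ S₃ (w G)
        ≡⟨ ∑-*ˡ S₃ ½ _ ⟩
      ½ · ∑ S₃ (λ T → ∑ (𝒪𝒦 G 5) (λ K → W G (take 4 K) · ψ G K T))
        ≡⟨ cong (½ ·_) (trans (∑-comm S₃ (𝒪𝒦 G 5) _) (∑-cong (𝒪𝒦 G 5) (λ K → ∑-*ˡ S₃ (W G (take 4 K)) (ψ G K)))) ⟩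
      ½ · ∑ (𝒪𝒦 G 5) (λ K → W G (take 4 K) · ∑ S₃ (ψ G K))
        ≡⟨ cong (½ ·_) (∑-filter isOrderedClique? (allTuples G 5) _) ⟩
      ½ · ∑ (allTuples G 5) (λ K → whenClique K (W G (take 4 K) · ∑ S₃ (ψ G K)))
        ≡⟨ cong (½ ·_) (trans (∑-allTuples 4 _) (∑-cong (allFin n) (λ a → ∑-allTuples 3 _))) ⟩
      ½ · ∑ (allFin n) (λ a → ∑ (allFin n) (λ b → ∑ (allTuples G 3) (λ t →
            whenClique (a ∷ b ∷ t) (W G (take 4 (a ∷ b ∷ t)) · ∑ S₃ (ψ G (a ∷ b ∷ t))))))
        ≡⟨ cong (½ ·_) (∑-cong (allFin n) (λ a → ∑-cong (allFin n) (∑-completions-ψ a))) ⟩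
      ½ · ∑ (allFin n) (λ a → ∑ (allFin n) (λ b → completionMass a b · (δ a u · δ b v + δ a v · δ b u)))
        ≡⟨ cong (½ ·_) (∑∑-δ-unordered (allFin n) completionMass (Unique.allFin⁺ n) (∈-allFin u) (∈-allFin v)) ⟩
      ½ · (completionMass u v + completionMass v u) ∎

open import Data.Nat using (ℕ; _*_; _<_)
open import Data.Fin using (Fin)
open import Data.Fin.Subset using (⁅_⁆; _∪_)
open import Data.List using (map)
open import Data.Rational using (1ℚ)
open import Relation.Binary.PropositionalEquality using (_≡_)

proposition3p11 : (n : ℕ) (G : Graph n)
    → (∀ v → 3 * n < 4 * degree G v)
    → (u v : Fin n) → Adj G u v
    → sumℚ G (map (w G) (𝒦 G 3 (⁅ u ⁆ ∪ ⁅ v ⁆))) ≡ 1ℚ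
proposition3p11 n G 3n<4δ u v u~v = begin
  ∑ (𝒦 G 3 (⁅ u ⁆ ∪ ⁅ v ⁆)) (w G)                ≡⟨ ∑-w-over-triangles u~v ⟩
  ½ · (completionMass u v + completionMass v u)  ≡⟨ cong (½ ·_) (cong₂ _+_ (completionMass≡1 u~v) (completionMass≡1 (sym G u~v))) ⟩
  ½ · (1ℚ + 1ℚ)                                  ≡⟨⟩
  1ℚ                                             ∎
  where
  open import Data.Rational using (_+_) renaming (_*_ to _·_)
  open import Relation.Binary.PropositionalEquality using (cong; cong₂)
  open Relation.Binary.PropositionalEquality.≡-Reasoning
  open ListSum using (∑)
  open Weights G 3n<4δ
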